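{- Let $r\ge1$ be an integer, and let $Q_{r+2}$ be the $(r+2)\times(r+2)$ matrix with $(Q_{r+2})_{i,i+1}=1$ for $1\le i\le r+1$, last row $(q_1,\dots,q_{r+2})$, and all other entries $0$, where $q_{r+2}=F^{(r)}_2$ and, for $k=1,\dots,r+1$, $q_{r+2-k}=F^{(r)}_{k+2}-\sum_{j=1}^{k}F^{(r)}_{k+2-j}\,q_{r+3-j}$. Then $\det(Q_{r+2})=-1$.
   Context: Let $(F_k)_{k\ge0}$ be the Fibonacci numbers, $F_0=0$, $F_1=1$, $F_{k+2}=F_{k+1}+F_k$. The hyperfibonacci numbers are defined for $k\ge 0$ by $F^{(0)}_k=F_k$ and, for $r\ge1$, $F^{(r)}_k=\sum_{j=0}^{k}F^{(r-1)}_j$ (so $F^{(r)}_0=0$, $F^{(r)}_1=1$). -}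

module Defs where

open import Data.Nat as ℕ using (ℕ; zero; suc)
open import Data.Integer using (ℤ; +_; -_; _+_; _*_; _-_; 0ℤ; 1ℤ)
open import Data.Fin using (Fin; zero; suc; toℕ; punchIn; fromℕ)
open import Data.List using (List; []; _∷_)
open import Data.Bool using (true; false)

fib : ℕ → ℕ
fib 0 = 0
fib 1 = 1
fib (suc (suc k)) = fib (suc k) ℕ.+ fib k

sumTo : (ℕ → ℕ) → ℕ → ℕ
sumTo f zero = f zero
sumTo f (suc k) = sumTo f k ℕ.+ f (suc k)

hfib : ℕ → ℕ → ℕ
hfib zero k = fib k
hfib (suc r) k = sumTo (hfib r) k

Fz : ℕ → ℕ → ℤ
Fz r k = + hfib r k

-- Write p_m = q_{r+2-m} (m = 0, …, r+1). The paper's recursion reads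
--   p_0 = F^{(r)}_2,
--   p_m = F^{(r)}_{m+2} - Σ_{j=1}^{m} F^{(r)}_{m+2-j} p_{j-1}
--       = F^{(r)}_{m+2} - Σ_{i=0}^{m-1} F^{(r)}_{m+1-i} p_i      (i = j-1).
-- (The case m = 0 is the same formula with an empty sum.)
-- pList r m = [p_{m-1}, …, p_0]  (reversed list of the earlier values).
-- conv r n [x_0, x_1, …] = Σ_t F^{(r)}_{n+t} x_t .
conv : ℕ → ℕ → List ℤ → ℤ
conv r n [] = 0ℤ
conv r n (x ∷ xs) = Fz r n * x + conv r (suc n) xs

mutual
  pval : ℕ → ℕ → ℤ
  pval r m = Fz r (m ℕ.+ 2) - conv r 2 (pList r m)

  pList : ℕ → ℕ → List ℤ
  pList r zero = []
  pList r (suc m) = pval r m ∷ pList r m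

-- q r i = q_{i+1} (0-based index i : Fin (r+2)), i.e. q_{r+2-k} with k = r+1-i
q : (r : ℕ) → Fin (suc (suc r)) → ℤ
q r i = pval r (suc r ℕ.∸ toℕ i)

Qmat : (r : ℕ) → Fin (suc (suc r)) → Fin (suc (suc r)) → ℤ
Qmat r i j with toℕ i ℕ.≡ᵇ suc r
... | true = q r j
... | false with toℕ j ℕ.≡ᵇ suc (toℕ i)
...   | true = 1ℤ
...   | false = 0ℤ

sumFin : (n : ℕ) → (Fin n → ℤ) → ℤ
sumFin zero f = 0ℤ
sumFin (suc n) f = f zero + sumFin n (λ j → f (suc j))

sgn : ℕ → ℤ
sgn zero = 1ℤ
sgn (suc k) = - sgn k

det : (n : ℕ) → (Fin n → Fin n → ℤ) → ℤ
det zero M = 1ℤ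
det (suc n) M =
  sumFin (suc n) (λ j → sgn (toℕ j) * M zero j * det n (λ a b → M (suc a) (punchIn j b)))

-- The generating function of F^{(r)} is x / ((1 - x - x²)(1 - x)^r), so if
-- a_k are the coefficients of (1 - x - x²)(1 - x)^r, the convolution Σ_k a_k F^{(r)}_{n-k}
-- vanishes for n ≥ 2. Since a_0 = 1, F^{(r)}_0 = 0 and F^{(r)}_1 = 1, this is exactly the
-- recursion defining the q's, which gives q_{r+2-m} = -a_{m+1}; in particular
-- q_1 = -a_{r+2} = (-1)^r. Expanding along the first row, the companion-type matrix Q_{r+2}
-- has determinant (-1)^{r+1} q_1 = -1.
module Submission where

open import Defs
open import Data.Nat using (ℕ; suc; _≥_)
open import Data.Integer using (ℤ; -_; 1ℤ)
open import Relation.Binary.PropositionalEquality using (_≡_)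

open import Data.Nat as ℕ using (zero)
import Data.Nat.Properties as ℕₚ
open import Data.Integer using (+_; _+_; _*_; _-_; 0ℤ)
open import Data.Integer.Properties using (pos-+; +-identityˡ; *-zeroʳ; neg-distribˡ-*; neg-distribʳ-*)
open import Data.Integer.Solver using (module +-*-Solver)
open import Data.Fin using (Fin; toℕ; punchIn) renaming (zero to fzero; suc to fsuc)
open import Data.Bool using (if_then_else_; true; false)
open import Data.List using (_∷_; applyDownFrom)
open import Relation.Binary.PropositionalEquality using (refl; sym; trans; cong; cong₂; module ≡-Reasoning)
open +-*-Solver

-- cv a G n = Σ_{k ≤ n} a_k G_{n-k}, the n-th coefficient of the product of generating functions.
cv : (ℕ → ℤ) → (ℕ → ℤ) → ℕ → ℤ
cv a G zero = a 0 * G 0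
cv a G (suc n) = a 0 * G (suc n) + cv (λ k → a (suc k)) G n

Δ : (ℕ → ℤ) → ℕ → ℤ
Δ a zero = a 0
Δ a (suc k) = a (suc k) - a k

cv-congʳ : ∀ a {G H} → (∀ i → G i ≡ H i) → ∀ n → cv a G n ≡ cv a H n
cv-congʳ a G≗H zero = cong (a 0 *_) (G≗H 0)
cv-congʳ a G≗H (suc n) = cong₂ _+_ (cong (a 0 *_) (G≗H (suc n))) (cv-congʳ _ G≗H n)

cv-zeroˡ : ∀ G n → cv (λ _ → 0ℤ) G n ≡ 0ℤ
cv-zeroˡ G zero = refl
cv-zeroˡ G (suc n) = trans (+-identityˡ _) (cv-zeroˡ G n)

cv-negˡ : ∀ a G n → cv (λ k → - a k) G n ≡ - cv a G n
cv-negˡ a G zero = sym (neg-distribˡ-* (a 0) (G 0))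
cv-negˡ a G (suc n) rewrite cv-negˡ (λ k → a (suc k)) G n =
  solve 3 (λ x g u → (:- x) :* g :+ (:- u) := :- (x :* g :+ u)) refl
    (a 0) (G (suc n)) (cv (λ k → a (suc k)) G n)

cv-∸ˡ : ∀ a b G n → cv (λ k → a k - b k) G n ≡ cv a G n - cv b G n
cv-∸ˡ a b G zero = solve 3 (λ x y g → (x :- y) :* g := x :* g :- y :* g) refl (a 0) (b 0) (G 0)
cv-∸ˡ a b G (suc n) rewrite cv-∸ˡ (λ k → a (suc k)) (λ k → b (suc k)) G n =
  solve 5 (λ x y g u v → (x :- y) :* g :+ (u :- v) := (x :* g :+ u) :- (y :* g :+ v)) refl
    (a 0) (b 0) (G (suc n)) (cv (λ k → a (suc k)) G n) (cv (λ k → b (suc k)) G n)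

cv-snoc : ∀ a G n → cv a G (suc n) ≡ cv a (λ i → G (suc i)) n + a (suc n) * G 0
cv-snoc a G zero = refl
cv-snoc a G (suc n) rewrite cv-snoc (λ k → a (suc k)) G n =
  solve 3 (λ x u y → x :+ (u :+ y) := (x :+ u) :+ y) refl
    (a 0 * G (suc (suc n))) (cv (λ k → a (suc k)) (λ i → G (suc i)) n) (a (suc (suc n)) * G 0)

cv-Δˡ : ∀ a G n → cv (Δ a) G (suc n) ≡ cv a G (suc n) - cv a G n
cv-Δˡ a G n rewrite cv-∸ˡ (λ k → a (suc k)) a G n =
  solve 3 (λ x u v → x :+ (u :- v) := (x :+ u) :- v) refl
    (a 0 * G (suc n)) (cv (λ k → a (suc k)) G n) (cv a G n)

cv-Δʳ : ∀ a G n → cv a (Δ G) (suc n) ≡ cv a G (suc n) - cv a G n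
cv-Δʳ a G zero =
  solve 4 (λ x y p q → x :* (p :- q) :+ y :* q := (x :* p :+ y :* q) :- x :* q) refl
    (a 0) (a 1) (G 1) (G 0)
cv-Δʳ a G (suc m) rewrite cv-Δʳ (λ k → a (suc k)) G m =
  solve 5 (λ x p q u v → x :* (p :- q) :+ (u :- v) := (x :* p :+ u) :- (x :* q :+ v)) refl
    (a 0) (G (suc (suc m))) (G (suc m)) (cv (λ k → a (suc k)) G (suc m)) (cv (λ k → a (suc k)) G m)

cv-Δ-swap : ∀ a G n → cv (Δ a) G n ≡ cv a (Δ G) n
cv-Δ-swap a G zero = refl
cv-Δ-swap a G (suc n) = trans (cv-Δˡ a G n) (sym (cv-Δʳ a G n))

hfib-zero : ∀ r → hfib r 0 ≡ 0
hfib-zero zero = refl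
hfib-zero (suc r) = hfib-zero r

hfib-one : ∀ r → hfib r 1 ≡ 1
hfib-one zero = refl
hfib-one (suc r) rewrite hfib-zero r | hfib-one r = refl

Δ-Fz-suc : ∀ r k → Δ (Fz (suc r)) k ≡ Fz r k
Δ-Fz-suc r zero = refl
Δ-Fz-suc r (suc k) rewrite pos-+ (sumTo (hfib r) k) (hfib r (suc k)) =
  solve 2 (λ s h → (s :+ h) :- s := h) refl (+ sumTo (hfib r) k) (+ hfib r (suc k))

-- denom r k is the coefficient of x^k in (1 - x - x²)(1 - x)^r.
denom : ℕ → ℕ → ℤ
denom zero 0 = 1ℤ
denom zero 1 = - 1ℤ
denom zero 2 = - 1ℤ
denom zero (suc (suc (suc k))) = 0ℤ
denom (suc r) = Δ (denom r)

δ₁ : ℕ → ℤ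
δ₁ 1 = 1ℤ
δ₁ _ = 0ℤ

cv-denom-Fz : ∀ r n → cv (denom r) (Fz r) n ≡ δ₁ n
cv-denom-Fz zero 0 = refl
cv-denom-Fz zero 1 = refl
cv-denom-Fz zero 2 = refl
cv-denom-Fz zero (suc (suc (suc k)))
  rewrite cv-zeroˡ (Fz zero) k | pos-+ (fib (suc (suc k))) (fib (suc k)) | pos-+ (fib (suc k)) (fib k) =
  solve 2 (λ x y → con 1ℤ :* ((x :+ y) :+ x) :+ (con (- 1ℤ) :* (x :+ y) :+ (con (- 1ℤ) :* x :+ con 0ℤ)) := con 0ℤ) refl
    (+ fib (suc k)) (+ fib k)
cv-denom-Fz (suc r) n = begin
  cv (Δ (denom r)) (Fz (suc r)) n   ≡⟨ cv-Δ-swap (denom r) (Fz (suc r)) n ⟩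
  cv (denom r) (Δ (Fz (suc r))) n   ≡⟨ cv-congʳ (denom r) (Δ-Fz-suc r) n ⟩
  cv (denom r) (Fz r) n             ≡⟨ cv-denom-Fz r n ⟩
  δ₁ n                              ∎
  where open ≡-Reasoning

denom-zero : ∀ r → denom r 0 ≡ 1ℤ
denom-zero zero = refl
denom-zero (suc r) = denom-zero r

denom-beyond-degree : ∀ r j → denom r (suc (suc (suc (r ℕ.+ j)))) ≡ 0ℤ
denom-beyond-degree zero j = refl
denom-beyond-degree (suc r) j = cong₂ _-_
  (trans (cong (λ e → denom r (suc (suc (suc e)))) (sym (ℕₚ.+-suc r j))) (denom-beyond-degree r (suc j)))
  (denom-beyond-degree r j)

denom-degree : ∀ r → denom r (suc (suc r)) ≡ sgn (suc r)
denom-degree zero = refl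
denom-degree (suc r) = begin
  denom r (suc (suc (suc r))) - denom r (suc (suc r))
    ≡⟨ cong₂ _-_ (trans (cong (λ e → denom r (suc (suc (suc e)))) (sym (ℕₚ.+-identityʳ r)))
                         (denom-beyond-degree r 0))
                 (denom-degree r) ⟩
  0ℤ - sgn (suc r)   ≡⟨ +-identityˡ _ ⟩
  sgn (suc (suc r))  ∎
  where open ≡-Reasoning

conv-applyDownFrom : ∀ r k f m →
  conv r k (applyDownFrom f (suc m)) ≡ cv f (λ i → Fz r (k ℕ.+ i)) m
conv-applyDownFrom r k f zero rewrite ℕₚ.+-identityʳ k =
  solve 2 (λ F x → F :* x :+ con 0ℤ := x :* F) refl (Fz r k) (f 0)
conv-applyDownFrom r k f (suc m) = begin
  Fz r k * f (suc m) + conv r (suc k) (applyDownFrom f (suc m))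
    ≡⟨ cong (λ w → Fz r k * f (suc m) + w) (conv-applyDownFrom r (suc k) f m) ⟩
  Fz r k * f (suc m) + cv f (λ i → Fz r (suc k ℕ.+ i)) m
    ≡⟨ cong₂ (λ t w → Fz r t * f (suc m) + w) (sym (ℕₚ.+-identityʳ k))
             (cv-congʳ f (λ i → cong (Fz r) (sym (ℕₚ.+-suc k i))) m) ⟩
  Fz r (k ℕ.+ 0) * f (suc m) + cv f (λ i → G (suc i)) m
    ≡⟨ solve 3 (λ F x u → F :* x :+ u := u :+ x :* F) refl (G 0) (f (suc m)) (cv f (λ i → G (suc i)) m) ⟩
  cv f (λ i → G (suc i)) m + f (suc m) * G 0
    ≡⟨ sym (cv-snoc f G m) ⟩
  cv f G (suc m) ∎
  where
  open ≡-Reasoning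
  G = λ i → Fz r (k ℕ.+ i)

-- Peeling off the first term F^{(r)}_1 c_m = c_m turns the defining recursion of pval into
-- this single equation for every m.
pval-unique : ∀ r (c : ℕ → ℤ) →
  (∀ m → conv r 1 (applyDownFrom c (suc m)) ≡ Fz r (m ℕ.+ 2)) → ∀ m → pval r m ≡ c m
pval-unique r c solves m = begin
  Fz r (m ℕ.+ 2) - conv r 2 (pList r m)              ≡⟨ cong (λ l → Fz r (m ℕ.+ 2) - conv r 2 l) (pList≡ m) ⟩
  Fz r (m ℕ.+ 2) - conv r 2 (applyDownFrom c m)      ≡⟨ cong (λ e → e - conv r 2 (applyDownFrom c m)) (sym (solves m)) ⟩
  (Fz r 1 * c m + conv r 2 (applyDownFrom c m)) - conv r 2 (applyDownFrom c m)
    ≡⟨ cong (λ e → (+ e * c m + conv r 2 (applyDownFrom c m)) - conv r 2 (applyDownFrom c m)) (hfib-one r) ⟩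
  (1ℤ * c m + conv r 2 (applyDownFrom c m)) - conv r 2 (applyDownFrom c m)
    ≡⟨ solve 2 (λ x u → (con 1ℤ :* x :+ u) :- u := x) refl (c m) (conv r 2 (applyDownFrom c m)) ⟩
  c m                                                ∎
  where
  open ≡-Reasoning
  pList≡ : ∀ m → pList r m ≡ applyDownFrom c m
  pList≡ zero = refl
  pList≡ (suc m) = cong₂ _∷_ (pval-unique r c solves m) (pList≡ m)

cv-denom-Fz-tail : ∀ r m →
  Fz r (suc (suc m)) + cv (λ k → denom r (suc k)) (λ i → Fz r (suc i)) m ≡ 0ℤ
cv-denom-Fz-tail r m = begin
  x + u                                          ≡⟨ solve 3 (λ x u y → x :+ u := con 1ℤ :* x :+ (u :+ y :* con 0ℤ)) refl x u y ⟩
  1ℤ * x + (u + y * 0ℤ)                          ≡⟨ cong₂ (λ p t → p * x + (u + y * t)) (sym (denom-zero r)) (cong +_ (sym (hfib-zero r))) ⟩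
  denom r 0 * x + (u + y * Fz r 0)               ≡⟨ cong (λ w → denom r 0 * x + w) (sym (cv-snoc a⁺ (Fz r) m)) ⟩
  cv (denom r) (Fz r) (suc (suc m))              ≡⟨ cv-denom-Fz r (suc (suc m)) ⟩
  0ℤ                                             ∎
  where
  open ≡-Reasoning
  a⁺ = λ k → denom r (suc k)
  x = Fz r (suc (suc m))
  u = cv a⁺ (λ i → Fz r (suc i)) m
  y = denom r (suc (suc m))

pval-denom : ∀ r m → pval r m ≡ - denom r (suc m)
pval-denom r = pval-unique r (λ k → - a⁺ k) solves
  where
  a⁺ = λ k → denom r (suc k)
  F⁺ = λ i → Fz r (suc i)
  solves : ∀ m → conv r 1 (applyDownFrom (λ k → - a⁺ k) (suc m)) ≡ Fz r (m ℕ.+ 2)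
  solves m = begin
    conv r 1 (applyDownFrom (λ k → - a⁺ k) (suc m))   ≡⟨ conv-applyDownFrom r 1 (λ k → - a⁺ k) m ⟩
    cv (λ k → - a⁺ k) F⁺ m                             ≡⟨ cv-negˡ a⁺ F⁺ m ⟩
    - u                                                ≡⟨ solve 2 (λ x u → :- u := x :- (x :+ u)) refl x u ⟩
    x - (x + u)                                        ≡⟨ cong (λ w → x - w) (cv-denom-Fz-tail r m) ⟩
    x - 0ℤ                                             ≡⟨ solve 1 (λ x → x :- con 0ℤ := x) refl x ⟩
    x                                                  ≡⟨ cong (Fz r) (ℕₚ.+-comm 2 m) ⟩
    Fz r (m ℕ.+ 2)                                     ∎
    where
    open ≡-Reasoning
    x = Fz r (suc (suc m))
    u = cv a⁺ F⁺ m

sumFin-cong : ∀ n {f g : Fin n → ℤ} → (∀ j → f j ≡ g j) → sumFin n f ≡ sumFin n g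
sumFin-cong zero f≗g = refl
sumFin-cong (suc n) f≗g = cong₂ _+_ (f≗g fzero) (sumFin-cong n (λ j → f≗g (fsuc j)))

sumFin-zero : ∀ n (f : Fin n → ℤ) → (∀ j → f j ≡ 0ℤ) → sumFin n f ≡ 0ℤ
sumFin-zero zero f f≗0 = refl
sumFin-zero (suc n) f f≗0 = cong₂ _+_ (f≗0 fzero) (sumFin-zero n _ (λ j → f≗0 (fsuc j)))

det-cong : ∀ n {M N : Fin n → Fin n → ℤ} → (∀ i j → M i j ≡ N i j) → det n M ≡ det n N
det-cong zero M≗N = refl
det-cong (suc n) M≗N = sumFin-cong (suc n) λ j →
  cong₂ _*_ (cong (sgn (toℕ j) *_) (M≗N fzero j)) (det-cong n (λ a b → M≗N (fsuc a) (punchIn j b)))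

det-firstRow-unit₁ : ∀ n (M : Fin (suc (suc n)) → Fin (suc (suc n)) → ℤ) →
  M fzero fzero ≡ 0ℤ → M fzero (fsuc fzero) ≡ 1ℤ → (∀ j → M fzero (fsuc (fsuc j)) ≡ 0ℤ) →
  det (suc (suc n)) M ≡ - det (suc n) (λ a b → M (fsuc a) (punchIn (fsuc fzero) b))
det-firstRow-unit₁ n M M₀₀ M₀₁ M₀ⱼ = begin
  1ℤ * M fzero fzero * minor fzero + (- 1ℤ * M fzero (fsuc fzero) * minor (fsuc fzero) + rest)
    ≡⟨ cong₂ (λ x y → 1ℤ * x * minor fzero + (- 1ℤ * y * minor (fsuc fzero) + rest)) M₀₀ M₀₁ ⟩
  1ℤ * 0ℤ * minor fzero + (- 1ℤ * 1ℤ * minor (fsuc fzero) + rest)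
    ≡⟨ cong (λ w → 1ℤ * 0ℤ * minor fzero + (- 1ℤ * 1ℤ * minor (fsuc fzero) + w)) rest≡0 ⟩
  1ℤ * 0ℤ * minor fzero + (- 1ℤ * 1ℤ * minor (fsuc fzero) + 0ℤ)
    ≡⟨ solve 2 (λ x y → con 1ℤ :* con 0ℤ :* x :+ (con (- 1ℤ) :* con 1ℤ :* y :+ con 0ℤ) := :- y) refl
         (minor fzero) (minor (fsuc fzero)) ⟩
  - minor (fsuc fzero) ∎
  where
  open ≡-Reasoning
  minor : Fin (suc (suc n)) → ℤ
  minor j = det (suc n) (λ a b → M (fsuc a) (punchIn j b))
  term : Fin n → ℤ
  term j = sgn (toℕ (fsuc (fsuc j))) * M fzero (fsuc (fsuc j)) * minor (fsuc (fsuc j))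
  rest = sumFin n term
  rest≡0 : rest ≡ 0ℤ
  rest≡0 = sumFin-zero n term λ j →
    trans (cong (λ x → sgn (suc (suc (toℕ j))) * x * minor (fsuc (fsuc j))) (M₀ⱼ j))
          (cong (_* minor (fsuc (fsuc j))) (*-zeroʳ (sgn (suc (suc (toℕ j))))))

companion : (n : ℕ) → (Fin (suc n) → ℤ) → Fin (suc n) → Fin (suc n) → ℤ
companion n c i j =
  if toℕ i ℕ.≡ᵇ n then c j else (if toℕ j ℕ.≡ᵇ suc (toℕ i) then 1ℤ else 0ℤ)

companion-minor : ∀ m (c : Fin (suc (suc m)) → ℤ) a b →
  companion (suc m) c (fsuc a) (punchIn (fsuc fzero) b) ≡ companion m (λ j → c (punchIn (fsuc fzero) j)) a b
companion-minor m c a fzero = refl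
companion-minor m c a (fsuc b) = refl

det-companion : ∀ n c → det (suc n) (companion n c) ≡ sgn n * c fzero
det-companion zero c = solve 1 (λ x → con 1ℤ :* x :* con 1ℤ :+ con 0ℤ := con 1ℤ :* x) refl (c fzero)
det-companion (suc m) c = begin
  det (suc (suc m)) (companion (suc m) c)
    ≡⟨ det-firstRow-unit₁ m (companion (suc m) c) refl refl (λ j → refl) ⟩
  - det (suc m) (λ a b → companion (suc m) c (fsuc a) (punchIn (fsuc fzero) b))
    ≡⟨ cong -_ (det-cong (suc m) (companion-minor m c)) ⟩
  - det (suc m) (companion m (λ j → c (punchIn (fsuc fzero) j)))
    ≡⟨ cong -_ (det-companion m (λ j → c (punchIn (fsuc fzero) j))) ⟩
  - (sgn m * c fzero)
    ≡⟨ neg-distribˡ-* (sgn m) (c fzero) ⟩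
  sgn (suc m) * c fzero ∎
  where open ≡-Reasoning

Qmat≗companion : ∀ r i j → Qmat r i j ≡ companion (suc r) (q r) i j
Qmat≗companion r i j with toℕ i ℕ.≡ᵇ suc r
... | true = refl
... | false with toℕ j ℕ.≡ᵇ suc (toℕ i)
...   | true = refl
...   | false = refl

sgn-square : ∀ k → sgn k * sgn k ≡ 1ℤ
sgn-square zero = refl
sgn-square (suc k) = trans (solve 1 (λ s → (:- s) :* (:- s) := s :* s) refl (sgn k)) (sgn-square k)

lemma2 : (r : ℕ) → r ≥ 1 → det (suc (suc r)) (Qmat r) ≡ - 1ℤ
lemma2 r _ = begin
  det (suc (suc r)) (Qmat r)                  ≡⟨ det-cong (suc (suc r)) (Qmat≗companion r) ⟩
  det (suc (suc r)) (companion (suc r) (q r)) ≡⟨ det-companion (suc r) (q r) ⟩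
  sgn (suc r) * pval r (suc r)                ≡⟨ cong (sgn (suc r) *_) (pval-denom r (suc r)) ⟩
  sgn (suc r) * - denom r (suc (suc r))       ≡⟨ cong (λ x → sgn (suc r) * - x) (denom-degree r) ⟩
  sgn (suc r) * - sgn (suc r)                 ≡⟨ neg-distribʳ-* (sgn (suc r)) (sgn (suc r)) ⟨
  - (sgn (suc r) * sgn (suc r))               ≡⟨ cong -_ (sgn-square (suc r)) ⟩
  - 1ℤ                                        ∎
  where open ≡-Reasoning
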